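{- Let $G=(V,E)$ be a connected graph on $n$ vertices with radius $r\geq 1$. Then \[\bar{\mathsf{C}}_C(G)\leq \frac{n-1}{n-1+\binom{r}{2}}.\]
   Context: For vertices $u,v$ of a connected graph $G=(V,E)$ with $|V|=n\ge2$, $d(u,v)$ is the distance between $u$ and $v$. The (normalised) closeness centrality of a vertex $v$ is $\bar{\mathsf{C}}_C(v)=\dfrac{n-1}{\sum_{w\in V}d(v,w)}$, and the closeness centrality of $G$ is $\bar{\mathsf{C}}_C(G)=\dfrac{1}{n}\sum_{v\in V}\bar{\mathsf{C}}_C(v)$. The eccentricity $\epsilon(v)$ of a vertex $v$ is $\max_{u\in V}d(u,v)$, and the radius of $G$ is $r=\min_{v\in V}\epsilon(v)$. -}

module Defs where

open import Data.Nat using (ℕ; zero; suc; _+_; _*_; _∸_; _≤_; _⊔_)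
open import Data.Nat.Combinatorics using (_C_)
open import Data.Fin using (Fin)
open import Data.List using (List; map; foldr; allFin)
open import Data.Nat.ListAction using (sum)
open import Data.Integer using (+_)
open import Data.Rational using (ℚ; _/_; 0ℚ) renaming (_+_ to _+ℚ_)
open import Data.Product using (Σ; ∃; _×_)
open import Relation.Binary.PropositionalEquality using (_≡_)
open import Relation.Nullary using (¬_)

record Graph (n : ℕ) : Set₁ where
  field
    Adj   : Fin n → Fin n → Set
    sym   : ∀ {u v} → Adj u v → Adj v u
    irrefl : ∀ {u} → ¬ Adj u u
open Graph public

data Walk {n : ℕ} (G : Graph n) : Fin n → Fin n → ℕ → Set where
  nil  : ∀ {u} → Walk G u u 0
  cons : ∀ {u w v k} → Adj G u w → Walk G w v k → Walk G u v (suc k)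

Connected : ∀ {n} → Graph n → Set
Connected {n} G = ∀ (u v : Fin n) → ∃ λ k → Walk G u v k

IsDistance : ∀ {n} → Graph n → Fin n → Fin n → ℕ → Set
IsDistance G u v k = Walk G u v k × (∀ j → Walk G u v j → k ≤ j)

IsDistanceFunction : ∀ {n} → Graph n → (Fin n → Fin n → ℕ) → Set
IsDistanceFunction {n} G d = ∀ (u v : Fin n) → IsDistance G u v (d u v)

ecc : ∀ {n} → (Fin n → Fin n → ℕ) → Fin n → ℕ
ecc {n} d v = foldr _⊔_ 0 (map (λ u → d u v) (allFin n))

IsRadius : ∀ {n} → (Fin n → Fin n → ℕ) → ℕ → Set
IsRadius {n} d r = (∃ λ (v : Fin n) → ecc d v ≡ r) × (∀ (v : Fin n) → r ≤ ecc d v)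

-- a / b as a rational, with the convention a / 0 = 0 (never used under the hypotheses).
_÷_ : ℕ → ℕ → ℚ
a ÷ zero  = 0ℚ
a ÷ suc b = (+ a) / suc b

distSum : ∀ {n} → (Fin n → Fin n → ℕ) → Fin n → ℕ
distSum {n} d v = sum (map (d v) (allFin n))

closenessV : ∀ {n} → (Fin n → Fin n → ℕ) → Fin n → ℚ
closenessV {n} d v = (n ∸ 1) ÷ distSum d v

sumℚ : List ℚ → ℚ
sumℚ = foldr _+ℚ_ 0ℚ

closenessG : ∀ {n} → (Fin n → Fin n → ℕ) → ℚ
closenessG {n} d = sumℚ (map (closenessV d) (allFin n)) Data.Rational.* (1 ÷ n)

module Submission where

-- Fix a vertex v and a vertex u farthest from v, so d(v,u) = ε(v) ≥ r. A shortest v–u path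
-- passes through vertices at every distance 0, 1, …, r from v. Splitting each distance as
-- d = min(1, d) + (d ∸ 1), the first parts sum to n − 1, while the second parts at those
-- r + 1 vertices alone contribute 0 + 0 + 1 + ⋯ + (r − 1) = C(r,2). So every vertex has
-- distance sum at least n − 1 + C(r,2), and its closeness, hence also the mean closeness,
-- is at most (n − 1)/(n − 1 + C(r,2)).

open import Defs hiding (sym)
import Algebra.Properties.CommutativeMonoid.Sum as ∑
open import Data.Empty using (⊥-elim)
open import Data.Fin using (Fin; zero; suc; toℕ; punchIn; punchOut)
open import Data.Fin.Properties
  using (toℕ-injective; toℕ≤pred[n]; punchIn-punchOut; punchOut-injective; punchInᵢ≢i)
  renaming (suc-injective to Fin-suc-injective)
import Data.Integer as ℤ
import Data.Integer.Properties as ℤₚ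
open import Data.List using (List; []; _∷_; map; allFin; length; tabulate)
open import Data.List.Membership.Propositional.Properties using (foldr-selective; ∈-map⁻)
open import Data.List.Properties using (map-tabulate; length-tabulate)
import Data.Nat.ListAction as List
open import Data.Nat using (ℕ; zero; suc; _+_; _∸_; _≤_; _⊓_; z≤n; s≤s)
open import Data.Nat.Combinatorics using (_C_; nC1≡n; nCk+nC[k+1]≡[n+1]C[k+1])
open import Data.Nat.Properties
open import Data.Product using (∃; _×_; _,_; proj₁; proj₂)
open import Data.Rational as ℚ using (ℚ; 1ℚ; toℚᵘ) renaming (_≤_ to _≤ℚ_)
import Data.Rational.Properties as ℚ
open import Data.Rational.Unnormalised as ℚᵘ using (mkℚᵘ; *≤*; *≡*)
import Data.Rational.Unnormalised.Properties as ℚᵘ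
open import Data.Sum using (inj₁; inj₂)
open import Function using (_∘_; id)
open import Function.Definitions using (Injective)
open import Relation.Binary.PropositionalEquality

open ∑ +-0-commutativeMonoid using (sum-cong-≗; ∑-distrib-+; sum-remove) renaming (sum to ∑)

∑-mono-≤ : ∀ {n} {f g : Fin n → ℕ} → (∀ i → f i ≤ g i) → ∑ f ≤ ∑ g
∑-mono-≤ {zero}  f≤g = z≤n
∑-mono-≤ {suc n} f≤g = +-mono-≤ (f≤g zero) (∑-mono-≤ (f≤g ∘ suc))

∑-const-1 : ∀ n → ∑ {n} (λ _ → 1) ≡ n
∑-const-1 zero    = refl
∑-const-1 (suc n) = cong suc (∑-const-1 n)

∑-toℕ : ∀ n → ∑ {n} toℕ ≡ n C 2
∑-toℕ zero    = refl
∑-toℕ (suc n) = begin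
  ∑ {n} (suc ∘ toℕ)               ≡⟨ ∑-distrib-+ {n} (λ _ → 1) toℕ ⟩
  ∑ {n} (λ _ → 1) + ∑ {n} toℕ     ≡⟨ cong₂ _+_ (trans (∑-const-1 n) (sym (nC1≡n n))) (∑-toℕ n) ⟩
  n C 1 + n C 2                   ≡⟨ nCk+nC[k+1]≡[n+1]C[k+1] n 1 ⟩
  suc n C 2                       ∎
  where open ≡-Reasoning

∑-∘-injective-≤ : ∀ {m n} {p : Fin m → Fin n} → Injective _≡_ _≡_ p →
                  (f : Fin n → ℕ) → ∑ (f ∘ p) ≤ ∑ f
∑-∘-injective-≤ {zero}                  _     f = z≤n
∑-∘-injective-≤ {suc m} {zero}  {p} _     f with p zero
... | ()
∑-∘-injective-≤ {suc m} {suc n} {p} p-inj f = begin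
  f p₀ + ∑ (f ∘ p ∘ suc)           ≡⟨ cong (f p₀ +_) (sum-cong-≗ (cong f ∘ sym ∘ punchIn-punchOut ∘ p₀≢p∘suc)) ⟩
  f p₀ + ∑ (f ∘ punchIn p₀ ∘ q)    ≤⟨ +-monoʳ-≤ (f p₀) (∑-∘-injective-≤ q-injective (f ∘ punchIn p₀)) ⟩
  f p₀ + ∑ (f ∘ punchIn p₀)        ≡⟨ sym (sum-remove f) ⟩
  ∑ f                              ∎
  where
  open ≤-Reasoning
  p₀ : Fin (suc n)
  p₀ = p zero
  p₀≢p∘suc : ∀ i → p₀ ≢ p (suc i)
  p₀≢p∘suc i eq with p-inj eq
  ... | ()
  q : Fin m → Fin n
  q i = punchOut (p₀≢p∘suc i)
  q-injective : Injective _≡_ _≡_ q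
  q-injective {i} {j} = Fin-suc-injective ∘ p-inj ∘ punchOut-injective (p₀≢p∘suc i) (p₀≢p∘suc j)

n∸1≤∑ : ∀ {n} (f : Fin n → ℕ) v → (∀ w → w ≢ v → 1 ≤ f w) → n ∸ 1 ≤ ∑ f
n∸1≤∑ {suc n} f v pos = begin
  n                          ≡⟨ ∑-const-1 n ⟨
  ∑ {n} (λ _ → 1)            ≤⟨ ∑-mono-≤ (λ j → pos (punchIn v j) (punchInᵢ≢i v j)) ⟩
  ∑ (f ∘ punchIn v)          ≤⟨ m≤n+m _ (f v) ⟩
  f v + ∑ (f ∘ punchIn v)    ≡⟨ sum-remove f ⟨
  ∑ f                        ∎
  where open ≤-Reasoning

kC2≤∑[f∸1] : ∀ {n k} (f : Fin n → ℕ) → (∀ i → i ≤ k → ∃ λ w → f w ≡ i) → k C 2 ≤ ∑ (λ w → f w ∸ 1)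
kC2≤∑[f∸1] {n} {k} f takes = begin
  k C 2                         ≡⟨ ∑-toℕ k ⟨
  -- ∑_{i ≤ k} (i ∸ 1) computes to ∑_{i < k} i.
  ∑ {suc k} (λ i → toℕ i ∸ 1)   ≡⟨ sum-cong-≗ (λ i → cong (_∸ 1) (sym (f∘p≗toℕ i))) ⟩
  ∑ (g ∘ p)                     ≤⟨ ∑-∘-injective-≤ p-injective g ⟩
  ∑ g                           ∎
  where
  open ≤-Reasoning
  g : Fin n → ℕ
  g w = f w ∸ 1
  p : Fin (suc k) → Fin n
  p i = proj₁ (takes (toℕ i) (toℕ≤pred[n] i))
  f∘p≗toℕ : ∀ i → f (p i) ≡ toℕ i
  f∘p≗toℕ i = proj₂ (takes (toℕ i) (toℕ≤pred[n] i))
  p-injective : Injective _≡_ _≡_ p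
  p-injective {i} {j} eq = toℕ-injective (trans (sym (f∘p≗toℕ i)) (trans (cong f eq) (f∘p≗toℕ j)))

sum-tabulate : ∀ {n} (f : Fin n → ℕ) → List.sum (tabulate f) ≡ ∑ f
sum-tabulate {zero}  f = refl
sum-tabulate {suc n} f = cong (f zero +_) (sum-tabulate (f ∘ suc))

sum-map-allFin : ∀ {n} (f : Fin n → ℕ) → List.sum (map f (allFin n)) ≡ ∑ f
sum-map-allFin f = trans (cong List.sum (map-tabulate id f)) (sum-tabulate f)

module _ {n} {G : Graph n} where

  _++ʷ_ : ∀ {a b c k l} → Walk G a b k → Walk G b c l → Walk G a c (k + l)
  nil      ++ʷ w = w
  cons e v ++ʷ w = cons e (v ++ʷ w)

  reverse-onto : ∀ {a b c k l} → Walk G a b k → Walk G a c l → Walk G b c (k + l)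
  reverse-onto         nil                acc = acc
  reverse-onto {l = l} (cons {k = k} e w) acc =
    subst (Walk G _ _) (+-suc k l) (reverse-onto w (cons (Defs.sym G e) acc))

  reverse : ∀ {a b k} → Walk G a b k → Walk G b a k
  reverse {k = k} w = subst (Walk G _ _) (+-identityʳ k) (reverse-onto w nil)

  splitAt : ∀ {a b} k {l} → Walk G a b (k + l) → ∃ λ w → Walk G a w k × Walk G w b l
  splitAt zero    w          = _ , nil , w
  splitAt (suc k) (cons e w) with splitAt k w
  ... | m , w₁ , w₂ = m , cons e w₁ , w₂

  nil-endpoints : ∀ {a b} → Walk G a b 0 → a ≡ b
  nil-endpoints nil = refl

module Distance {n} {G : Graph n} {d : Fin n → Fin n → ℕ} (isDist : IsDistanceFunction G d) where

  walk : ∀ u v → Walk G u v (d u v)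
  walk u v = proj₁ (isDist u v)

  minimal : ∀ {u v k} → Walk G u v k → d u v ≤ k
  minimal {u} {v} = proj₂ (isDist u v) _

  d-sym : ∀ u v → d u v ≡ d v u
  d-sym u v = ≤-antisym (minimal (reverse (walk v u))) (minimal (reverse (walk u v)))

  d-pos : ∀ {v w} → w ≢ v → 1 ≤ d v w
  d-pos {v} {w} w≢v with d v w | walk v w
  ... | zero  | W = ⊥-elim (w≢v (sym (nil-endpoints W)))
  ... | suc _ | _ = s≤s z≤n

  -- Cut a shortest v–u walk after k steps; its first piece must itself be shortest.
  vertex-at-distance : ∀ {v u k} → k ≤ d v u → ∃ λ w → d v w ≡ k
  vertex-at-distance {v} {u} {k} k≤d with splitAt k (subst (Walk G v u) (sym (m+[n∸m]≡n k≤d)) (walk v u))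
  ... | w , W₁ , W₂ = w , ≤-antisym (minimal W₁) k≤d[v,w]
    where
    k≤d[v,w] : k ≤ d v w
    k≤d[v,w] = +-cancelʳ-≤ (d v u ∸ k) k (d v w)
      (subst (_≤ d v w + (d v u ∸ k)) (sym (m+[n∸m]≡n k≤d)) (minimal (walk v w ++ʷ W₂)))

  distSum-bound : ∀ {v u k} → k ≤ d v u → (n ∸ 1) + k C 2 ≤ ∑ (d v)
  distSum-bound {v} {u} {k} k≤d = begin
    (n ∸ 1) + k C 2                              ≤⟨ +-mono-≤ near far ⟩
    ∑ (λ w → 1 ⊓ d v w) + ∑ (λ w → d v w ∸ 1)    ≡⟨ ∑-distrib-+ (λ w → 1 ⊓ d v w) (λ w → d v w ∸ 1) ⟨
    ∑ (λ w → 1 ⊓ d v w + (d v w ∸ 1))            ≡⟨ sum-cong-≗ (λ w → m⊓n+n∸m≡n 1 (d v w)) ⟩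
    ∑ (d v)                                      ∎
    where
    open ≤-Reasoning
    near : n ∸ 1 ≤ ∑ (λ w → 1 ⊓ d v w)
    near = n∸1≤∑ (λ w → 1 ⊓ d v w) v (λ w w≢v → ⊓-glb ≤-refl (d-pos w≢v))
    far : k C 2 ≤ ∑ (λ w → d v w ∸ 1)
    far = kC2≤∑[f∸1] (d v) (λ i i≤k → vertex-at-distance (≤-trans i≤k k≤d))

ecc-attained : ∀ {n} (d : Fin n → Fin n → ℕ) v → ∃ λ u → ecc d v ≤ d u v
ecc-attained {n} d v with foldr-selective ⊔-sel 0 (map (λ u → d u v) (allFin n))
... | inj₁ ecc≡0 = v , subst (_≤ d v v) (sym ecc≡0) z≤n
... | inj₂ ecc∈  with ∈-map⁻ (λ u → d u v) ecc∈
...   | u , _ , ecc≡ = u , ≤-reflexive ecc≡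

toℚᵘ-÷ : ∀ a b → toℚᵘ (a ÷ suc b) ℚᵘ.≃ mkℚᵘ (ℤ.+ a) b
toℚᵘ-÷ a b = ℚ.toℚᵘ-fromℚᵘ (mkℚᵘ (ℤ.+ a) b)

÷-antitone : ∀ a {D S} → 1 ≤ D → D ≤ S → a ÷ S ≤ℚ a ÷ D
÷-antitone a {suc t} {suc s} _ D≤S = ℚ.toℚᵘ-cancel-≤ (begin
  toℚᵘ (a ÷ suc s)     ≃⟨ toℚᵘ-÷ a s ⟩
  mkℚᵘ (ℤ.+ a) s       ≤⟨ *≤* (ℤₚ.*-monoˡ-≤-nonNeg (ℤ.+ a) (ℤ.+≤+ D≤S)) ⟩
  mkℚᵘ (ℤ.+ a) t       ≃⟨ toℚᵘ-÷ a t ⟨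
  toℚᵘ (a ÷ suc t)     ∎)
  where open ℚᵘ.≤-Reasoning

suc÷1 : ∀ k → suc k ÷ 1 ≡ 1ℚ ℚ.+ k ÷ 1
suc÷1 k = ℚ.toℚᵘ-injective (begin
  toℚᵘ (suc k ÷ 1)                ≈⟨ toℚᵘ-÷ (suc k) 0 ⟩
  mkℚᵘ (ℤ.+ suc k) 0              ≈⟨ *≡* (trans (ℤₚ.*-identityʳ _) (sym 1+k≡1*1+k*1)) ⟩
  ℚᵘ.1ℚᵘ ℚᵘ.+ mkℚᵘ (ℤ.+ k) 0      ≈⟨ ℚᵘ.+-congʳ ℚᵘ.1ℚᵘ (toℚᵘ-÷ k 0) ⟨
  toℚᵘ 1ℚ ℚᵘ.+ toℚᵘ (k ÷ 1)       ≈⟨ ℚ.toℚᵘ-homo-+ 1ℚ (k ÷ 1) ⟨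
  toℚᵘ (1ℚ ℚ.+ k ÷ 1)             ∎)
  where
  open ℚᵘ.≃-Reasoning
  1+k≡1*1+k*1 : (ℤ.1ℤ ℤ.* ℤ.1ℤ ℤ.+ ℤ.+ k ℤ.* ℤ.1ℤ) ℤ.* ℤ.1ℤ ≡ ℤ.+ suc k
  1+k≡1*1+k*1 = trans (ℤₚ.*-identityʳ _) (cong (ℤ._+_ (ℤ.+ 1)) (ℤₚ.*-identityʳ (ℤ.+ k)))

÷-inverse : ∀ m → (suc m ÷ 1) ℚ.* (1 ÷ suc m) ≡ 1ℚ
÷-inverse m = ℚ.toℚᵘ-injective (begin
  toℚᵘ ((suc m ÷ 1) ℚ.* (1 ÷ suc m))              ≈⟨ ℚ.toℚᵘ-homo-* (suc m ÷ 1) (1 ÷ suc m) ⟩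
  toℚᵘ (suc m ÷ 1) ℚᵘ.* toℚᵘ (1 ÷ suc m)         ≈⟨ ℚᵘ.*-cong (toℚᵘ-÷ (suc m) 0) (toℚᵘ-÷ 1 m) ⟩
  mkℚᵘ (ℤ.+ suc m) 0 ℚᵘ.* mkℚᵘ (ℤ.+ 1) m          ≈⟨ ℚᵘ.*-inverseʳ (mkℚᵘ (ℤ.+ suc m) 0) ⟩
  ℚᵘ.1ℚᵘ                                          ∎)
  where open ℚᵘ.≃-Reasoning

sumℚ-mono-≤ : ∀ {A : Set} (xs : List A) {f g : A → ℚ} → (∀ x → f x ≤ℚ g x) →
              sumℚ (map f xs) ≤ℚ sumℚ (map g xs)
sumℚ-mono-≤ []       f≤g = ℚ.≤-refl
sumℚ-mono-≤ (x ∷ xs) f≤g = ℚ.+-mono-≤ (f≤g x) (sumℚ-mono-≤ xs f≤g)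

sumℚ-const : ∀ {A : Set} (xs : List A) q → sumℚ (map (λ _ → q) xs) ≡ q ℚ.* (length xs ÷ 1)
sumℚ-const []       q = sym (ℚ.*-zeroʳ q)
sumℚ-const (x ∷ xs) q = begin
  q ℚ.+ sumℚ (map (λ _ → q) xs)         ≡⟨ cong₂ ℚ._+_ (sym (ℚ.*-identityʳ q)) (sumℚ-const xs q) ⟩
  q ℚ.* 1ℚ ℚ.+ q ℚ.* (length xs ÷ 1)    ≡⟨ ℚ.*-distribˡ-+ q 1ℚ (length xs ÷ 1) ⟨
  q ℚ.* (1ℚ ℚ.+ length xs ÷ 1)          ≡⟨ cong (q ℚ.*_) (suc÷1 (length xs)) ⟨
  q ℚ.* (suc (length xs) ÷ 1)           ∎
  where open ≡-Reasoning

mean-≤ : ∀ m (f : Fin (suc m) → ℚ) q → (∀ i → f i ≤ℚ q) →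
         sumℚ (map f (allFin (suc m))) ℚ.* (1 ÷ suc m) ≤ℚ q
mean-≤ m f q f≤q = begin
  sumℚ (map f vs) ℚ.* c                 ≤⟨ ℚ.*-monoʳ-≤-nonNeg c {{ℚ.normalize-nonNeg 1 (suc m)}} (sumℚ-mono-≤ vs f≤q) ⟩
  sumℚ (map (λ _ → q) vs) ℚ.* c         ≡⟨ cong (ℚ._* c) (sumℚ-const vs q) ⟩
  q ℚ.* (length vs ÷ 1) ℚ.* c           ≡⟨ cong (λ l → q ℚ.* (l ÷ 1) ℚ.* c) (length-tabulate {n = suc m} id) ⟩
  q ℚ.* (suc m ÷ 1) ℚ.* c               ≡⟨ ℚ.*-assoc q (suc m ÷ 1) c ⟩
  q ℚ.* ((suc m ÷ 1) ℚ.* c)             ≡⟨ cong (q ℚ.*_) (÷-inverse m) ⟩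
  q ℚ.* 1ℚ                              ≡⟨ ℚ.*-identityʳ q ⟩
  q                                     ∎
  where
  open ℚ.≤-Reasoning
  vs : List (Fin (suc m))
  vs = allFin (suc m)
  c : ℚ
  c = 1 ÷ suc m

theorem6 : (n : ℕ) → 2 ≤ n → (G : Graph n) → Connected G →
           (d : Fin n → Fin n → ℕ) → IsDistanceFunction G d →
           (r : ℕ) → IsRadius d r → 1 ≤ r →
           closenessG d ≤ℚ ((n ∸ 1) ÷ ((n ∸ 1) + r C 2))
theorem6 (suc (suc m)) (s≤s (s≤s _)) _ _ d isDist r (_ , r≤ecc) _ =
  mean-≤ (suc m) (closenessV d) _ closeness-bound
  where
  open Distance isDist
  closeness-bound : ∀ v → closenessV d v ≤ℚ (suc m ÷ (suc m + r C 2))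
  closeness-bound v with ecc-attained d v
  ... | u , ecc≤d[u,v] = ÷-antitone (suc m) (s≤s z≤n)
    (subst (suc m + r C 2 ≤_) (sym (sum-map-allFin (d v)))
      (distSum-bound (≤-trans (r≤ecc v) (≤-trans ecc≤d[u,v] (≤-reflexive (d-sym u v))))))
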